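{- There exist $g_1,g_2\in\mathbb{R}[X_1,\dots,X_n,Y_1,\dots,Y_n]$, each of degree $1$, with no common zero on $\{0,1\}^{2n}$, such that whenever $h_1,h_2\in\mathbb{R}[X_1,\dots,X_n,Y_1,\dots,Y_n]$ satisfy $h_1(z)g_1(z)+h_2(z)g_2(z)=1$ for all $z\in\{0,1\}^{2n}$, we have \[ \max\big(\deg(\overline{h_1g_1}),\deg(\overline{h_2g_2})\big)\ge n, \] where $\overline{r}$ denotes the multilinearization of $r$ obtained by applying the relations $X_i^2=X_i$, $Y_i^2=Y_i$ for all $i$.
   Formalization: The polynomials $g_1,g_2$ and $h_1,h_2$ have rational coefficients instead of real ones. -}

module Defs where

open import Data.Bool using (Bool; true; false; if_then_else_)
open import Data.Empty using (⊥)
open import Data.List using (List; []; _∷_; _++_; map; concatMap; foldr)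
open import Data.Maybe using (Maybe; just; nothing)
open import Data.Nat as ℕ using (ℕ; zero; suc; _≤_; _⊓_; _⊔_)
open import Data.Product using (_×_; _,_)
open import Data.Rational as ℚ using (ℚ; 0ℚ; 1ℚ; _+_; _*_)
open import Data.Rational.Properties using (_≟_)
open import Data.Vec as Vec using (Vec; zipWith; toList)
import Data.Vec.Properties as VecP
import Data.Nat.Properties as ℕP
open import Relation.Nullary.Decidable using (⌊_⌋)
import Data.Nat.ListAction

Monomial : ℕ → Set
Monomial k = Vec ℕ k

-- Polynomials with rational coefficients in k variables, as finite formal
-- sums of terms c · x^e (representation need not be normalised).
Poly : ℕ → Set
Poly k = List (ℚ × Monomial k)

totalDeg : ∀ {k} → Monomial k → ℕ
totalDeg m = Data.Nat.ListAction.sum (toList m)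

_*P_ : ∀ {k} → Poly k → Poly k → Poly k
p *P q = concatMap (λ { (c , m) → map (λ { (d , m′) → (c * d , zipWith ℕ._+_ m m′) }) q }) p

coeff : ∀ {k} → Poly k → Monomial k → ℚ
coeff p m = foldr (λ { (c , m′) acc → if ⌊ VecP.≡-dec ℕP._≟_ m′ m ⌋ then c + acc else acc }) 0ℚ p

-- degree: nothing for the zero polynomial (degree -∞), otherwise the
-- maximal total degree of a monomial with nonzero coefficient
maxM : Maybe ℕ → Maybe ℕ → Maybe ℕ
maxM nothing b = b
maxM (just a) nothing = just a
maxM (just a) (just b) = just (a ⊔ b)

deg : ∀ {k} → Poly k → Maybe ℕ
deg p = foldr (λ { (_ , m) acc → if ⌊ coeff p m ≟ 0ℚ ⌋ then acc else maxM (just (totalDeg m)) acc }) nothing p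

_≤deg_ : ℕ → Maybe ℕ → Set
d ≤deg nothing = ⊥
d ≤deg just e = d ≤ e

-- multilinearization: apply x_i^2 = x_i, i.e. replace each exponent e by min(e,1)
multilin : ∀ {k} → Poly k → Poly k
multilin = map (λ { (c , m) → (c , Vec.map (_⊓ 1) m) })

bit : Bool → ℚ
bit true = 1ℚ
bit false = 0ℚ

powQ : ℚ → ℕ → ℚ
powQ x zero = 1ℚ
powQ x (suc e) = x * powQ x e

evalMon : ∀ {k} → Monomial k → Vec Bool k → ℚ
evalMon m z = foldr _*_ 1ℚ (toList (zipWith (λ e b → powQ (bit b) e) m z))

eval : ∀ {k} → Poly k → Vec Bool k → ℚ
eval p z = foldr (λ { (c , m) acc → c * evalMon m z + acc }) 0ℚ p

{-# OPTIONS --safe #-}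

-- Take g₁ = ΣXᵢ and g₂ = ΣXᵢ − ΣYᵢ − 1. They have no common zero on the cube, and already
-- p = multilin (h₁ g₁) has degree at least n: p vanishes where x = 0 (there g₁ = 0) and equals 1
-- where |x| = |y| + 1 (there g₂ = 0), so the linear functional
--
--   Φ F = Σ_{|x| = |y| + 1} (−1)^|x| |y|! (n − |y|)! (F (x , y) − F (0 , y))
--
-- takes the value −n! on p. But Φ kills every monomial x^S y^T with |S| + |T| < n: for S = ∅
-- every summand vanishes, and otherwise the sum over y is, as a function of |x| ≥ 1, a multiple
-- of the falling factorial of |x| − 1 of degree |T|, which the alternating sum over the subcube
-- {x ⊇ S} of dimension n − |S| > |T| annihilates.

module Submission where

open import Defs
open import Algebra.Bundles using (CommutativeRing)
open import Data.Bool using (Bool; true; false; if_then_else_)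
open import Data.Empty using (⊥-elim)
open import Data.List as L using ([]; _∷_)
open import Data.List.Relation.Unary.All as All using (All; []; _∷_)
import Data.List.Relation.Unary.All.Properties as AllP
open import Data.Maybe using (Maybe; just; nothing)
import Data.Maybe.Relation.Unary.All as Maybe
open import Data.Nat as ℕ using (ℕ; zero; suc; _≤_; _<_; z≤n; s≤s; _!; _∸_)
open import Data.Nat.Induction using (<-wellFounded)
import Data.Nat.ListAction as ListAction
import Data.Nat.ListAction.Properties as ListActionP
import Data.Nat.Properties as ℕP
open import Data.Product using (Σ; _×_; _,_; proj₁; proj₂)
open import Data.Rational using (ℚ; 0ℚ; 1ℚ; _+_; _*_; _-_; -_; Positive; NonNegative)
open import Data.Rational.Properties as ℚP using (+-*-commutativeRing)
open import Data.Rational.Solver using (module +-*-Solver)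
open import Data.Sum using (_⊎_; inj₁)
open import Data.Vec as Vec using (Vec; []; _∷_; _++_; replicate)
import Data.Vec.Properties as VecP
open import Function using (_∘_; case_of_)
open import Induction.WellFounded using (Acc; acc)
open import Relation.Binary.PropositionalEquality
open import Relation.Nullary using (¬_; Dec; yes; no)
open import Relation.Nullary.Decidable using (⌊_⌋; decidable-stable)
open import Algebra.Properties.CommutativeSemigroup
  (CommutativeRing.+-commutativeSemigroup +-*-commutativeRing) as +-CS using ()
open import Algebra.Properties.CommutativeSemigroup
  (CommutativeRing.*-commutativeSemigroup +-*-commutativeRing) as *-CS using ()
open import Algebra.Properties.Semiring.Mult (CommutativeRing.semiring +-*-commutativeRing)
  using (×-homo-+; ×1-homo-*) renaming (_×_ to _×ℚ_)

open ≡-Reasoning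
open +-*-Solver using (solve; _:=_; _:+_; _:*_; :-_; _:-_; con)

ι : ℕ → ℚ
ι n = n ×ℚ 1ℚ

ι-+ : ∀ m n → ι (m ℕ.+ n) ≡ ι m + ι n
ι-+ = ×-homo-+ 1ℚ

ι-suc-! : ∀ n → ι (suc n !) ≡ ι (suc n) * ι (n !)
ι-suc-! n = ×1-homo-* (suc n) (n !)

ι-pred : ∀ b → ι b ≡ ι (suc b) - 1ℚ
ι-pred b = cancel (ι b)
  where
  cancel : ∀ x → x ≡ 1ℚ + x - 1ℚ
  cancel = solve 1 (λ x → x := con 1ℚ :+ x :- con 1ℚ) refl

ι-≢0 : ∀ {n} → 1 ≤ n → ι n ≢ 0ℚ
ι-≢0 {suc n} _ = ≢-sym (ℚP.<⇒≢ (ℚP.positive⁻¹ (ι (suc n)) {{positive}}))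
  where
  nonNegative : ∀ n → NonNegative (ι n)
  nonNegative zero = _
  nonNegative (suc n) = ℚP.nonNeg+nonNeg⇒nonNeg 1ℚ (ι n) {{nonNegative n}}
  positive : Positive (ι (suc n))
  positive = ℚP.pos+nonNeg⇒pos 1ℚ (ι n) {{nonNegative n}}

sgn : ℕ → ℚ
sgn zero = 1ℚ
sgn (suc a) = - sgn a

δ : ℕ → ℕ → ℚ
δ zero zero = 1ℚ
δ zero (suc b) = 0ℚ
δ (suc a) zero = 0ℚ
δ (suc a) (suc b) = δ a b

δ-≢ : ∀ {a b} → a ≢ b → δ a b ≡ 0ℚ
δ-≢ {zero} {zero} a≢b = ⊥-elim (a≢b refl)
δ-≢ {zero} {suc b} a≢b = refl
δ-≢ {suc a} {zero} a≢b = refl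
δ-≢ {suc a} {suc b} a≢b = δ-≢ (a≢b ∘ cong suc)

δ-resp : ∀ a b {x y} → (a ≡ b → x ≡ y) → δ a b * x ≡ δ a b * y
δ-resp a b {x} {y} x≡y with a ℕ.≟ b
... | yes a≡b = cong (δ a b *_) (x≡y a≡b)
... | no a≢b = begin
  δ a b * x ≡⟨ cong (_* x) (δ-≢ a≢b) ⟩
  0ℚ * x    ≡⟨ ℚP.*-zeroˡ x ⟩
  0ℚ        ≡⟨ ℚP.*-zeroˡ y ⟨
  0ℚ * y    ≡⟨ cong (_* y) (δ-≢ a≢b) ⟨
  δ a b * y ∎

weight : ∀ {k} → Vec Bool k → ℕ
weight [] = 0
weight (false ∷ x) = weight x
weight (true ∷ x) = suc (weight x)

origin : ∀ k → Vec Bool k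
origin k = replicate k false

weight-origin : ∀ k → weight (origin k) ≡ 0
weight-origin zero = refl
weight-origin (suc k) = weight-origin k

weight≤ : ∀ {k} (x : Vec Bool k) → weight x ≤ k
weight≤ [] = z≤n
weight≤ (false ∷ x) = ℕP.m≤n⇒m≤1+n (weight≤ x)
weight≤ (true ∷ x) = s≤s (weight≤ x)

weight≡0 : ∀ {k} (x : Vec Bool k) → weight x ≡ 0 → x ≡ origin k
weight≡0 [] _ = refl
weight≡0 (false ∷ x) eq = cong (false ∷_) (weight≡0 x eq)

-- wsum k ω F = Σ_{x ∈ {0,1}ᵏ} ω |x| · F x
wsum : ∀ k → (ℕ → ℚ) → (Vec Bool k → ℚ) → ℚ
wsum zero ω F = ω 0 * F []
wsum (suc k) ω F = wsum k ω (F ∘ (false ∷_)) + wsum k (ω ∘ suc) (F ∘ (true ∷_))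

wsum-cong : ∀ k {ω ω′} {F G : Vec Bool k → ℚ} →
            (∀ x → ω (weight x) * F x ≡ ω′ (weight x) * G x) → wsum k ω F ≡ wsum k ω′ G
wsum-cong zero eq = eq []
wsum-cong (suc k) eq = cong₂ _+_ (wsum-cong k (eq ∘ (false ∷_))) (wsum-cong k (eq ∘ (true ∷_)))

wsum-congʷ : ∀ k {ω ω′} {F : Vec Bool k → ℚ} → (∀ a → ω a ≡ ω′ a) → wsum k ω F ≡ wsum k ω′ F
wsum-congʷ k {F = F} eq = wsum-cong k (λ x → cong (_* F x) (eq (weight x)))

wsum-zero : ∀ k {ω} {F : Vec Bool k → ℚ} → (∀ x → ω (weight x) * F x ≡ 0ℚ) → wsum k ω F ≡ 0ℚ
wsum-zero zero eq = eq []
wsum-zero (suc k) eq =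
  trans (cong₂ _+_ (wsum-zero k (eq ∘ (false ∷_))) (wsum-zero k (eq ∘ (true ∷_)))) (ℚP.+-identityˡ 0ℚ)

wsum-+ : ∀ k ω (F G : Vec Bool k → ℚ) → wsum k ω (λ x → F x + G x) ≡ wsum k ω F + wsum k ω G
wsum-+ zero ω F G = ℚP.*-distribˡ-+ (ω 0) (F []) (G [])
wsum-+ (suc k) ω F G = begin
  wsum k ω (λ x → F₀ x + G₀ x) + wsum k (ω ∘ suc) (λ x → F₁ x + G₁ x)
    ≡⟨ cong₂ _+_ (wsum-+ k ω F₀ G₀) (wsum-+ k (ω ∘ suc) F₁ G₁) ⟩
  (wsum k ω F₀ + wsum k ω G₀) + (wsum k (ω ∘ suc) F₁ + wsum k (ω ∘ suc) G₁)
    ≡⟨ +-CS.interchange (wsum k ω F₀) (wsum k ω G₀) (wsum k (ω ∘ suc) F₁) (wsum k (ω ∘ suc) G₁) ⟩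
  (wsum k ω F₀ + wsum k (ω ∘ suc) F₁) + (wsum k ω G₀ + wsum k (ω ∘ suc) G₁) ∎
  where
  F₀ F₁ G₀ G₁ : Vec Bool k → ℚ
  F₀ = F ∘ (false ∷_)
  F₁ = F ∘ (true ∷_)
  G₀ = G ∘ (false ∷_)
  G₁ = G ∘ (true ∷_)

wsum-* : ∀ k ω (F : Vec Bool k → ℚ) c → wsum k ω (λ x → c * F x) ≡ c * wsum k ω F
wsum-* zero ω F c = *-CS.x∙yz≈y∙xz (ω 0) c (F [])
wsum-* (suc k) ω F c =
  trans (cong₂ _+_ (wsum-* k ω _ c) (wsum-* k (ω ∘ suc) _ c)) (sym (ℚP.*-distribˡ-+ c _ _))

wsum-+ʷ : ∀ k ω ω′ (F : Vec Bool k → ℚ) → wsum k (λ a → ω a + ω′ a) F ≡ wsum k ω F + wsum k ω′ F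
wsum-+ʷ zero ω ω′ F = ℚP.*-distribʳ-+ (F []) (ω 0) (ω′ 0)
wsum-+ʷ (suc k) ω ω′ F = begin
  wsum k (λ a → ω a + ω′ a) F₀ + wsum k (λ a → ω (suc a) + ω′ (suc a)) F₁
    ≡⟨ cong₂ _+_ (wsum-+ʷ k ω ω′ F₀) (wsum-+ʷ k (ω ∘ suc) (ω′ ∘ suc) F₁) ⟩
  (wsum k ω F₀ + wsum k ω′ F₀) + (wsum k (ω ∘ suc) F₁ + wsum k (ω′ ∘ suc) F₁)
    ≡⟨ +-CS.interchange (wsum k ω F₀) (wsum k ω′ F₀) (wsum k (ω ∘ suc) F₁) (wsum k (ω′ ∘ suc) F₁) ⟩
  (wsum k ω F₀ + wsum k (ω ∘ suc) F₁) + (wsum k ω′ F₀ + wsum k (ω′ ∘ suc) F₁) ∎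
  where
  F₀ F₁ : Vec Bool k → ℚ
  F₀ = F ∘ (false ∷_)
  F₁ = F ∘ (true ∷_)

wsum-*ʷ : ∀ k ω (F : Vec Bool k → ℚ) c → wsum k (λ a → c * ω a) F ≡ c * wsum k ω F
wsum-*ʷ zero ω F c = ℚP.*-assoc c (ω 0) (F [])
wsum-*ʷ (suc k) ω F c =
  trans (cong₂ _+_ (wsum-*ʷ k ω _ c) (wsum-*ʷ k (ω ∘ suc) _ c)) (sym (ℚP.*-distribˡ-+ c _ _))

wsum-δ₀ : ∀ k (F : Vec Bool k → ℚ) → wsum k (δ 0) F ≡ F (origin k)
wsum-δ₀ zero F = ℚP.*-identityˡ (F [])
wsum-δ₀ (suc k) F = begin
  wsum k (δ 0) (F ∘ (false ∷_)) + wsum k (λ _ → 0ℚ) (F ∘ (true ∷_))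
    ≡⟨ cong₂ _+_ (wsum-δ₀ k _) (wsum-zero k (λ x → ℚP.*-zeroˡ (F (true ∷ x)))) ⟩
  F (origin (suc k)) + 0ℚ
    ≡⟨ ℚP.+-identityʳ _ ⟩
  F (origin (suc k)) ∎

wsum-δ-beyond : ∀ k b (F : Vec Bool k → ℚ) → k < b → wsum k (δ b) F ≡ 0ℚ
wsum-δ-beyond k b F k<b = wsum-zero k (λ x →
  trans (cong (_* F x) (δ-≢ (λ b≡w → ℕP.<⇒≱ k<b (subst (_≤ k) (sym b≡w) (weight≤ x))))) (ℚP.*-zeroˡ (F x)))

falling : ℕ → ℚ → ℚ
falling zero r = 1ℚ
falling (suc j) r = r * falling j (r - 1ℚ)

falling-sucʳ : ∀ j r → falling (suc j) r ≡ falling j r * (r - ι j)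
falling-sucʳ zero r = trans (ℚP.*-identityʳ r) (sym (trans (ℚP.*-identityˡ _) (ℚP.+-identityʳ r)))
falling-sucʳ (suc j) r = begin
  r * falling (suc j) (r - 1ℚ)               ≡⟨ cong (r *_) (falling-sucʳ j (r - 1ℚ)) ⟩
  r * (falling j (r - 1ℚ) * (r - 1ℚ - ι j)) ≡⟨ regroup r (falling j (r - 1ℚ)) (ι j) ⟩
  r * falling j (r - 1ℚ) * (r - (1ℚ + ι j)) ∎
  where
  regroup : ∀ r f i → r * (f * (r - 1ℚ - i)) ≡ r * f * (r - (1ℚ + i))
  regroup = solve 3 (λ r f i → r :* (f :* (r :- con 1ℚ :- i)) := r :* f :* (r :- (con 1ℚ :+ i))) refl

falling-Δ : ∀ j r → falling (suc j) (r + 1ℚ) - falling (suc j) r ≡ ι (suc j) * falling j r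
falling-Δ j r = begin
  (r + 1ℚ) * falling j (r + 1ℚ - 1ℚ) - falling (suc j) r
    ≡⟨ cong₂ (λ s t → (r + 1ℚ) * falling j s - t) (cancel r) (falling-sucʳ j r) ⟩
  (r + 1ℚ) * falling j r - falling j r * (r - ι j)
    ≡⟨ collect r (falling j r) (ι j) ⟩
  (1ℚ + ι j) * falling j r ∎
  where
  cancel : ∀ r → r + 1ℚ - 1ℚ ≡ r
  cancel = solve 1 (λ r → r :+ con 1ℚ :- con 1ℚ := r) refl
  collect : ∀ r f i → (r + 1ℚ) * f - f * (r - i) ≡ (1ℚ + i) * f
  collect = solve 3 (λ r f i → (r :+ con 1ℚ) :* f :- f :* (r :- i) := (con 1ℚ :+ i) :* f) refl

Δ : (ℕ → ℚ) → ℕ → ℚ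
Δ K a = K (suc a) - K a

Deg< : ℕ → (ℕ → ℚ) → Set
Deg< zero K = ∀ a → K a ≡ 0ℚ
Deg< (suc d) K = Deg< d (Δ K)

Deg<-cong : ∀ d {K K′} → (∀ a → K a ≡ K′ a) → Deg< d K → Deg< d K′
Deg<-cong zero eq h a = trans (sym (eq a)) (h a)
Deg<-cong (suc d) eq h = Deg<-cong d (λ a → cong₂ _-_ (eq (suc a)) (eq a)) h

Deg<-shift : ∀ d K → Deg< d K → Deg< d (K ∘ suc)
Deg<-shift zero K h = h ∘ suc
Deg<-shift (suc d) K h = Deg<-shift d (Δ K) h

Deg<-suc : ∀ d K → Deg< d K → Deg< (suc d) K
Deg<-suc zero K h a = trans (cong₂ _-_ (h (suc a)) (h a)) (ℚP.+-inverseʳ 0ℚ)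
Deg<-suc (suc d) K h = Deg<-suc d (Δ K) h

Deg<-≤ : ∀ {d d′} K → d ≤ d′ → Deg< d K → Deg< d′ K
Deg<-≤ {d′ = zero} K z≤n h = h
Deg<-≤ {d′ = suc d′} K z≤n h = Deg<-suc d′ K (Deg<-≤ {d′ = d′} K z≤n h)
Deg<-≤ K (s≤s d≤d′) h = Deg<-≤ (Δ K) d≤d′ h

Deg<-* : ∀ d c K → Deg< d K → Deg< d (λ a → c * K a)
Deg<-* zero c K h a = trans (cong (c *_) (h a)) (ℚP.*-zeroʳ c)
Deg<-* (suc d) c K h = Deg<-cong d distrib (Deg<-* d c (Δ K) h)
  where
  distrib : ∀ a → c * Δ K a ≡ c * K (suc a) - c * K a
  distrib a = trans (ℚP.*-distribˡ-+ c _ _) (cong (c * K (suc a) +_) (sym (ℚP.neg-distribʳ-* c (K a))))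

Deg<-falling : ∀ j s → Deg< (suc j) (λ a → falling j (ι a + s))
Deg<-falling zero s a = ℚP.+-inverseʳ 1ℚ
Deg<-falling (suc j) s = Deg<-cong (suc j) Δfalling (Deg<-* (suc j) (ι (suc j)) _ (Deg<-falling j s))
  where
  Δfalling : ∀ a → ι (suc j) * falling j (ι a + s) ≡ Δ (λ a → falling (suc j) (ι a + s)) a
  Δfalling a = begin
    ι (suc j) * falling j (ι a + s)
      ≡⟨ falling-Δ j (ι a + s) ⟨
    falling (suc j) (ι a + s + 1ℚ) - falling (suc j) (ι a + s)
      ≡⟨ cong (λ r → falling (suc j) r - falling (suc j) (ι a + s)) (shuffle (ι a) s) ⟩
    falling (suc j) (ι (suc a) + s) - falling (suc j) (ι a + s) ∎
    where
    shuffle : ∀ x s → x + s + 1ℚ ≡ (1ℚ + x) + s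
    shuffle = solve 2 (λ x s → x :+ s :+ con 1ℚ := (con 1ℚ :+ x) :+ s) refl

1ᵐ : ∀ k → Monomial k
1ᵐ k = replicate k 0

vars nonvars : ∀ {k} → Monomial k → ℕ
vars [] = 0
vars (zero ∷ m) = vars m
vars (suc _ ∷ m) = suc (vars m)
nonvars [] = 0
nonvars (zero ∷ m) = suc (nonvars m)
nonvars (suc _ ∷ m) = nonvars m

vars+nonvars : ∀ {k} (m : Monomial k) → vars m ℕ.+ nonvars m ≡ k
vars+nonvars [] = refl
vars+nonvars (zero ∷ m) = trans (ℕP.+-suc (vars m) (nonvars m)) (cong suc (vars+nonvars m))
vars+nonvars (suc _ ∷ m) = cong suc (vars+nonvars m)

vars≤totalDeg : ∀ {k} (m : Monomial k) → vars m ≤ totalDeg m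
vars≤totalDeg [] = z≤n
vars≤totalDeg (zero ∷ m) = vars≤totalDeg m
vars≤totalDeg (suc e ∷ m) = s≤s (ℕP.≤-trans (vars≤totalDeg m) (ℕP.m≤n+m (totalDeg m) e))

vars-1ᵐ : ∀ k → vars (1ᵐ k) ≡ 0
vars-1ᵐ zero = refl
vars-1ᵐ (suc k) = vars-1ᵐ k

nonvars-1ᵐ : ∀ k → nonvars (1ᵐ k) ≡ k
nonvars-1ᵐ zero = refl
nonvars-1ᵐ (suc k) = cong suc (nonvars-1ᵐ k)

totalDeg-++ : ∀ {k l} (m : Monomial k) (m′ : Monomial l) → totalDeg (m ++ m′) ≡ totalDeg m ℕ.+ totalDeg m′
totalDeg-++ m m′ = trans (cong ListAction.sum (VecP.toList-++ m m′)) (ListActionP.sum-++ (Vec.toList m) (Vec.toList m′))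

totalDeg-1ᵐ : ∀ k → totalDeg (1ᵐ k) ≡ 0
totalDeg-1ᵐ zero = refl
totalDeg-1ᵐ (suc k) = totalDeg-1ᵐ k

totalDeg-padʳ : ∀ {k} l (e : Monomial k) → totalDeg (e ++ 1ᵐ l) ≡ totalDeg e
totalDeg-padʳ l e = trans (totalDeg-++ e (1ᵐ l)) (trans (cong (totalDeg e ℕ.+_) (totalDeg-1ᵐ l)) (ℕP.+-identityʳ _))

totalDeg-padˡ : ∀ {k} l (e : Monomial k) → totalDeg (1ᵐ l ++ e) ≡ totalDeg e
totalDeg-padˡ l e = trans (totalDeg-++ (1ᵐ l) e) (cong (ℕ._+ totalDeg e) (totalDeg-1ᵐ l))

powQ-1 : ∀ e → powQ 1ℚ e ≡ 1ℚ
powQ-1 zero = refl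
powQ-1 (suc e) = trans (ℚP.*-identityˡ _) (powQ-1 e)

evalMon-const : ∀ {k} (m : Monomial k) → vars m ≡ 0 → ∀ x → evalMon m x ≡ 1ℚ
evalMon-const [] _ [] = refl
evalMon-const (zero ∷ m) vars≡0 (b ∷ x) = trans (ℚP.*-identityˡ _) (evalMon-const m vars≡0 x)

evalMon-origin : ∀ {k} (m : Monomial k) → 1 ≤ vars m → evalMon m (origin k) ≡ 0ℚ
evalMon-origin (zero ∷ m) 1≤vars = trans (ℚP.*-identityˡ _) (evalMon-origin m 1≤vars)
evalMon-origin {suc k} (suc e ∷ m) _ =
  trans (cong (_* evalMon m (origin k)) (ℚP.*-zeroˡ (powQ 0ℚ e))) (ℚP.*-zeroˡ (evalMon m (origin k)))

evalMon-++ : ∀ {k l} (m : Monomial k) (m′ : Monomial l) x y →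
             evalMon (m ++ m′) (x ++ y) ≡ evalMon m x * evalMon m′ y
evalMon-++ [] m′ [] y = sym (ℚP.*-identityˡ _)
evalMon-++ (e ∷ m) m′ (b ∷ x) y = trans (cong (powQ (bit b) e *_) (evalMon-++ m m′ x y))
                                        (sym (ℚP.*-assoc (powQ (bit b) e) (evalMon m x) (evalMon m′ y)))

wsum-evalMon-0∷ : ∀ k ω (m : Monomial k) →
                  wsum (suc k) ω (evalMon (0 ∷ m)) ≡ wsum k ω (evalMon m) + wsum k (ω ∘ suc) (evalMon m)
wsum-evalMon-0∷ k ω m =
  cong₂ _+_ (wsum-cong k (λ x → cong (ω (weight x) *_) (ℚP.*-identityˡ (evalMon m x))))
            (wsum-cong k (λ x → cong (ω (suc (weight x)) *_) (ℚP.*-identityˡ (evalMon m x))))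

wsum-evalMon-suc∷ : ∀ k ω e (m : Monomial k) →
                    wsum (suc k) ω (evalMon (suc e ∷ m)) ≡ wsum k (ω ∘ suc) (evalMon m)
wsum-evalMon-suc∷ k ω e m = begin
  wsum k ω (λ x → 0ℚ * powQ 0ℚ e * evalMon m x) + wsum k (ω ∘ suc) (λ x → powQ 1ℚ (suc e) * evalMon m x)
    ≡⟨ cong₂ _+_ (wsum-zero k (λ x → annihilate (ω (weight x)) (powQ 0ℚ e) (evalMon m x)))
                 (wsum-cong k (λ x → cong (λ t → ω (suc (weight x)) * (t * evalMon m x)) (powQ-1 (suc e)))) ⟩
  0ℚ + wsum k (ω ∘ suc) (λ x → 1ℚ * evalMon m x)
    ≡⟨ ℚP.+-identityˡ _ ⟩
  wsum k (ω ∘ suc) (λ x → 1ℚ * evalMon m x)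
    ≡⟨ wsum-cong k (λ x → cong (ω (suc (weight x)) *_) (ℚP.*-identityˡ (evalMon m x))) ⟩
  wsum k (ω ∘ suc) (evalMon m) ∎
  where
  annihilate : ∀ w p e → w * (0ℚ * p * e) ≡ 0ℚ
  annihilate = solve 3 (λ w p e → w :* (con 0ℚ :* p :* e) := con 0ℚ) refl

-- A free variable turns K into −Δ K, a variable of m shifts K by one.
alternating-wsum-vanishes : ∀ {k} (m : Monomial k) K → Deg< (nonvars m) K →
                            wsum k (λ a → sgn a * K a) (evalMon m) ≡ 0ℚ
alternating-wsum-vanishes [] K h = cong (λ t → 1ℚ * t * 1ℚ) (h 0)
alternating-wsum-vanishes {suc k} (zero ∷ m) K h = begin
  wsum (suc k) (λ a → sgn a * K a) (evalMon (0 ∷ m))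
    ≡⟨ wsum-evalMon-0∷ k _ m ⟩
  wsum k (λ a → sgn a * K a) (evalMon m) + wsum k (λ a → - sgn a * K (suc a)) (evalMon m)
    ≡⟨ wsum-+ʷ k _ _ (evalMon m) ⟨
  wsum k (λ a → sgn a * K a + - sgn a * K (suc a)) (evalMon m)
    ≡⟨ wsum-congʷ k (λ a → regroup (sgn a) (K a) (K (suc a))) ⟩
  wsum k (λ a → - 1ℚ * (sgn a * Δ K a)) (evalMon m)
    ≡⟨ wsum-*ʷ k _ (evalMon m) (- 1ℚ) ⟩
  - 1ℚ * wsum k (λ a → sgn a * Δ K a) (evalMon m)
    ≡⟨ cong (- 1ℚ *_) (alternating-wsum-vanishes m (Δ K) h) ⟩
  - 1ℚ * 0ℚ
    ≡⟨ ℚP.*-zeroʳ (- 1ℚ) ⟩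
  0ℚ ∎
  where
  regroup : ∀ s x y → s * x + - s * y ≡ - 1ℚ * (s * (y - x))
  regroup = solve 3 (λ s x y → s :* x :+ :- s :* y := :- con 1ℚ :* (s :* (y :- x))) refl
alternating-wsum-vanishes {suc k} (suc e ∷ m) K h = begin
  wsum (suc k) (λ a → sgn a * K a) (evalMon (suc e ∷ m))
    ≡⟨ wsum-evalMon-suc∷ k _ e m ⟩
  wsum k (λ a → - sgn a * K (suc a)) (evalMon m)
    ≡⟨ wsum-congʷ k (λ a → sign-out (sgn a) (K (suc a))) ⟩
  wsum k (λ a → - 1ℚ * (sgn a * K (suc a))) (evalMon m)
    ≡⟨ wsum-*ʷ k _ (evalMon m) (- 1ℚ) ⟩
  - 1ℚ * wsum k (λ a → sgn a * K (suc a)) (evalMon m)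
    ≡⟨ cong (- 1ℚ *_) (alternating-wsum-vanishes m (K ∘ suc) (Deg<-shift (nonvars m) K h)) ⟩
  - 1ℚ * 0ℚ
    ≡⟨ ℚP.*-zeroʳ (- 1ℚ) ⟩
  0ℚ ∎
  where
  sign-out : ∀ s y → - s * y ≡ - 1ℚ * (s * y)
  sign-out = solve 2 (λ s y → :- s :* y := :- con 1ℚ :* (s :* y)) refl

-- wsum k (δ b) (evalMon m) counts the points of weight b on which m is 1, i.e. it is the binomial
-- coefficient C (nonvars m) (b − vars m); count-formula is this multiplied by b! (k − b)!.
private
  W : ∀ {k} → (ℕ → ℚ) → Monomial k → ℚ
  W {k} ω m = wsum k ω (evalMon m)

  R : ∀ {k} → Monomial k → ℚ → ℚ
  R m r = ι (nonvars m !) * falling (vars m) r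

  rotate : ∀ x y z w → y * (x * z) * w ≡ x * (y * z * w)
  rotate = solve 4 (λ x y z w → y :* (x :* z) :* w := x :* (y :* z :* w)) refl

count-formula : ∀ {k} (m : Monomial k) b c → b ℕ.+ c ≡ k →
                ι (b !) * ι (c !) * W (δ b) m ≡ R m (ι b)

count-formula-off : ∀ {k} (m : Monomial k) b c → b ℕ.+ c ≡ suc k →
                    ι (b !) * ι (c !) * W (δ b) m ≡ ι c * R m (ι b)
count-formula-off {k} m b zero b+0≡1+k = begin
  ι (b !) * ι (0 !) * W (δ b) m
    ≡⟨ cong (ι (b !) * ι (0 !) *_) (wsum-δ-beyond k b (evalMon m) k<b) ⟩
  ι (b !) * ι (0 !) * 0ℚ
    ≡⟨ ℚP.*-zeroʳ (ι (b !) * ι (0 !)) ⟩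
  0ℚ
    ≡⟨ ℚP.*-zeroˡ (R m (ι b)) ⟨
  0ℚ * R m (ι b) ∎
  where
  k<b : k < b
  k<b = ℕP.≤-reflexive (sym (trans (sym (ℕP.+-identityʳ b)) b+0≡1+k))
count-formula-off m b (suc c) b+1+c≡1+k = begin
  ι (b !) * ι (suc c !) * W (δ b) m
    ≡⟨ cong (λ t → ι (b !) * t * W (δ b) m) (ι-suc-! c) ⟩
  ι (b !) * (ι (suc c) * ι (c !)) * W (δ b) m
    ≡⟨ rotate (ι (suc c)) (ι (b !)) (ι (c !)) (W (δ b) m) ⟩
  ι (suc c) * (ι (b !) * ι (c !) * W (δ b) m)
    ≡⟨ cong (ι (suc c) *_) (count-formula m b c (ℕP.suc-injective (trans (sym (ℕP.+-suc b c)) b+1+c≡1+k))) ⟩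
  ι (suc c) * R m (ι b) ∎

count-formula-on : ∀ {k} (m : Monomial k) b c → b ℕ.+ c ≡ suc k →
                   ι (b !) * ι (c !) * W (δ b ∘ suc) m ≡ ι b * R m (ι b - 1ℚ)
count-formula-on {k} m zero c _ = begin
  ι (0 !) * ι (c !) * W (λ _ → 0ℚ) m
    ≡⟨ cong (ι (0 !) * ι (c !) *_) (wsum-zero k (λ x → ℚP.*-zeroˡ (evalMon m x))) ⟩
  ι (0 !) * ι (c !) * 0ℚ
    ≡⟨ ℚP.*-zeroʳ (ι (0 !) * ι (c !)) ⟩
  0ℚ
    ≡⟨ ℚP.*-zeroˡ (R m (0ℚ - 1ℚ)) ⟨
  0ℚ * R m (0ℚ - 1ℚ) ∎
count-formula-on m (suc b) c 1+b+c≡1+k = begin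
  ι (suc b !) * ι (c !) * W (δ b) m
    ≡⟨ cong (λ t → t * ι (c !) * W (δ b) m) (ι-suc-! b) ⟩
  ι (suc b) * ι (b !) * ι (c !) * W (δ b) m
    ≡⟨ assoc4 (ι (suc b)) (ι (b !)) (ι (c !)) (W (δ b) m) ⟩
  ι (suc b) * (ι (b !) * ι (c !) * W (δ b) m)
    ≡⟨ cong (ι (suc b) *_) (count-formula m b c (ℕP.suc-injective 1+b+c≡1+k)) ⟩
  ι (suc b) * R m (ι b)
    ≡⟨ cong (λ r → ι (suc b) * R m r) (ι-pred b) ⟩
  ι (suc b) * R m (ι (suc b) - 1ℚ) ∎
  where
  assoc4 : ∀ x y z w → x * y * z * w ≡ x * (y * z * w)
  assoc4 = solve 4 (λ x y z w → x :* y :* z :* w := x :* (y :* z :* w)) refl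

count-formula [] zero zero refl = refl
count-formula {suc k} (zero ∷ m) b c b+c≡1+k = begin
  ι (b !) * ι (c !) * W (δ b) (0 ∷ m)
    ≡⟨ cong (ι (b !) * ι (c !) *_) (wsum-evalMon-0∷ k (δ b) m) ⟩
  ι (b !) * ι (c !) * (W (δ b) m + W (δ b ∘ suc) m)
    ≡⟨ ℚP.*-distribˡ-+ (ι (b !) * ι (c !)) _ _ ⟩
  ι (b !) * ι (c !) * W (δ b) m + ι (b !) * ι (c !) * W (δ b ∘ suc) m
    ≡⟨ cong₂ _+_ (count-formula-off m b c b+c≡1+k) (count-formula-on m b c b+c≡1+k) ⟩
  ι c * (Z * f) + ι b * (Z * falling j (ι b - 1ℚ))
    ≡⟨ cong (λ t → ι c * (Z * f) + t) (*-CS.x∙yz≈y∙xz (ι b) Z _) ⟩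
  ι c * (Z * f) + Z * falling (suc j) (ι b)
    ≡⟨ cong (λ t → ι c * (Z * f) + Z * t) (falling-sucʳ j (ι b)) ⟩
  ι c * (Z * f) + Z * (f * (ι b - ι j))
    ≡⟨ collect (ι b) (ι c) (ι j) Z f ⟩
  (ι b + ι c - ι j) * Z * f
    ≡⟨ cong (λ t → (t - ι j) * Z * f) weights ⟩
  (ι j + ι (suc z) - ι j) * Z * f
    ≡⟨ cancel (ι j) (ι (suc z)) Z f ⟩
  ι (suc z) * Z * f
    ≡⟨ cong (_* f) (ι-suc-! z) ⟨
  ι (suc z !) * f ∎
  where
  j = vars m
  z = nonvars m
  Z = ι (z !)
  f = falling j (ι b)
  weights : ι b + ι c ≡ ι j + ι (suc z)
  weights = begin
    ι b + ι c           ≡⟨ ι-+ b c ⟨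
    ι (b ℕ.+ c)         ≡⟨ cong ι (trans b+c≡1+k (cong suc (sym (vars+nonvars m)))) ⟩
    ι (suc (j ℕ.+ z))   ≡⟨ cong ι (ℕP.+-suc j z) ⟨
    ι (j ℕ.+ suc z)     ≡⟨ ι-+ j (suc z) ⟩
    ι j + ι (suc z)     ∎
  collect : ∀ b c j Z f → c * (Z * f) + Z * (f * (b - j)) ≡ (b + c - j) * Z * f
  collect = solve 5 (λ b c j Z f → c :* (Z :* f) :+ Z :* (f :* (b :- j)) := (b :+ c :- j) :* Z :* f) refl
  cancel : ∀ j s Z f → (j + s - j) * Z * f ≡ s * Z * f
  cancel = solve 4 (λ j s Z f → (j :+ s :- j) :* Z :* f := s :* Z :* f) refl
count-formula {suc k} (suc e ∷ m) b c b+c≡1+k = begin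
  ι (b !) * ι (c !) * W (δ b) (suc e ∷ m)
    ≡⟨ cong (ι (b !) * ι (c !) *_) (wsum-evalMon-suc∷ k (δ b) e m) ⟩
  ι (b !) * ι (c !) * W (δ b ∘ suc) m
    ≡⟨ count-formula-on m b c b+c≡1+k ⟩
  ι b * (ι (nonvars m !) * falling (vars m) (ι b - 1ℚ))
    ≡⟨ *-CS.x∙yz≈y∙xz (ι b) (ι (nonvars m !)) _ ⟩
  ι (nonvars m !) * falling (suc (vars m)) (ι b) ∎

eval-++ : ∀ {k} (p q : Poly k) z → eval (p L.++ q) z ≡ eval p z + eval q z
eval-++ [] q z = sym (ℚP.+-identityˡ _)
eval-++ ((c , m) ∷ p) q z =
  trans (cong (c * evalMon m z +_) (eval-++ p q z)) (sym (ℚP.+-assoc (c * evalMon m z) (eval p z) (eval q z)))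

powQ-+ : ∀ r a b → powQ r (a ℕ.+ b) ≡ powQ r a * powQ r b
powQ-+ r zero b = sym (ℚP.*-identityˡ _)
powQ-+ r (suc a) b = trans (cong (r *_) (powQ-+ r a b)) (sym (ℚP.*-assoc r _ _))

evalMon-zipWith-+ : ∀ {k} (m m′ : Monomial k) z → evalMon (Vec.zipWith ℕ._+_ m m′) z ≡ evalMon m z * evalMon m′ z
evalMon-zipWith-+ [] [] [] = sym (ℚP.*-identityˡ 1ℚ)
evalMon-zipWith-+ (e ∷ m) (e′ ∷ m′) (b ∷ z) = begin
  powQ (bit b) (e ℕ.+ e′) * evalMon (Vec.zipWith ℕ._+_ m m′) z
    ≡⟨ cong₂ _*_ (powQ-+ (bit b) e e′) (evalMon-zipWith-+ m m′ z) ⟩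
  powQ (bit b) e * powQ (bit b) e′ * (evalMon m z * evalMon m′ z)
    ≡⟨ *-CS.interchange (powQ (bit b) e) (powQ (bit b) e′) (evalMon m z) (evalMon m′ z) ⟩
  powQ (bit b) e * evalMon m z * (powQ (bit b) e′ * evalMon m′ z) ∎

eval-*P : ∀ {k} (p q : Poly k) z → eval (p *P q) z ≡ eval p z * eval q z
eval-*P [] q z = sym (ℚP.*-zeroˡ (eval q z))
eval-*P ((c , m) ∷ p) q z = begin
  eval (c·m*q L.++ (p *P q)) z          ≡⟨ eval-++ c·m*q (p *P q) z ⟩
  eval c·m*q z + eval (p *P q) z        ≡⟨ cong₂ _+_ (eval-term* q) (eval-*P p q z) ⟩
  c * evalMon m z * eval q z + eval p z * eval q z
                                        ≡⟨ ℚP.*-distribʳ-+ (eval q z) (c * evalMon m z) (eval p z) ⟨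
  (c * evalMon m z + eval p z) * eval q z ∎
  where
  c·m*q = L.map (λ { (d , m′) → (c * d , Vec.zipWith ℕ._+_ m m′) }) q
  expand : ∀ c d a b r → c * d * (a * b) + c * a * r ≡ c * a * (d * b + r)
  expand = solve 5 (λ c d a b r → c :* d :* (a :* b) :+ c :* a :* r := c :* a :* (d :* b :+ r)) refl
  eval-term* : ∀ q → eval (L.map (λ { (d , m′) → (c * d , Vec.zipWith ℕ._+_ m m′) }) q) z ≡ c * evalMon m z * eval q z
  eval-term* [] = sym (ℚP.*-zeroʳ (c * evalMon m z))
  eval-term* ((d , m′) ∷ q) = trans (cong₂ _+_ (cong (c * d *_) (evalMon-zipWith-+ m m′ z)) (eval-term* q))
                                    (expand c d (evalMon m z) (evalMon m′ z) (eval q z))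

powQ-⊓1 : ∀ b e → powQ (bit b) (e ℕ.⊓ 1) ≡ powQ (bit b) e
powQ-⊓1 b zero = refl
powQ-⊓1 b (suc zero) = refl
powQ-⊓1 true (suc (suc e)) = sym (trans (ℚP.*-identityˡ _) (powQ-1 (suc e)))
powQ-⊓1 false (suc (suc e)) = trans (ℚP.*-zeroˡ 1ℚ) (sym (ℚP.*-zeroˡ (powQ 0ℚ (suc e))))

eval-multilin : ∀ {k} (p : Poly k) z → eval (multilin p) z ≡ eval p z
eval-multilin [] z = refl
eval-multilin ((c , m) ∷ p) z = cong₂ (λ u v → c * u + v) (evalMon-⊓1 m z) (eval-multilin p z)
  where
  evalMon-⊓1 : ∀ {k} (m : Monomial k) z → evalMon (Vec.map (ℕ._⊓ 1) m) z ≡ evalMon m z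
  evalMon-⊓1 [] [] = refl
  evalMon-⊓1 (e ∷ m) (b ∷ z) = cong₂ _*_ (powQ-⊓1 b e) (evalMon-⊓1 m z)

eval-multilin-*P : ∀ {k} (h g : Poly k) z → eval (multilin (h *P g)) z ≡ eval h z * eval g z
eval-multilin-*P h g z = trans (eval-multilin (h *P g) z) (eval-*P h g z)

-- The decision procedure inside Defs.coeff, so that coeff computes under a matching `with`.
_≟ₘ_ : ∀ {k} (m m′ : Monomial k) → Dec (m ≡ m′)
_≟ₘ_ = VecP.≡-dec ℕP._≟_

without : ∀ {k} → Monomial k → Poly k → Poly k
without m [] = []
without m ((c , m′) ∷ p) with m′ ≟ₘ m
... | yes _ = without m p
... | no _ = (c , m′) ∷ without m p

coeff-head : ∀ {k} c (m : Monomial k) rest → coeff ((c , m) ∷ rest) m ≡ c + coeff rest m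
coeff-head c m rest with m ≟ₘ m
... | yes _ = refl
... | no m≢m = ⊥-elim (m≢m refl)

coeff-absent : ∀ {k} (m : Monomial k) rest → All (λ t → proj₂ t ≢ m) rest → coeff rest m ≡ 0ℚ
coeff-absent m [] [] = refl
coeff-absent m ((c , m′) ∷ rest) (m′≢m ∷ absent) with m′ ≟ₘ m
... | yes m′≡m = ⊥-elim (m′≢m m′≡m)
... | no _ = coeff-absent m rest absent

coeff-without : ∀ {k} m m′ (p : Poly k) → m′ ≢ m → coeff (without m p) m′ ≡ coeff p m′
coeff-without m m′ [] _ = refl
coeff-without m m′ ((c , m″) ∷ p) m′≢m with m″ ≟ₘ m
... | yes refl with m ≟ₘ m′
...   | yes refl = ⊥-elim (m′≢m refl)
...   | no _ = coeff-without m m′ p m′≢m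
coeff-without m m′ ((c , m″) ∷ p) m′≢m | no _ with m″ ≟ₘ m′
...   | yes _ = cong (c +_) (coeff-without m m′ p m′≢m)
...   | no _ = coeff-without m m′ p m′≢m

coeff-without-self : ∀ {k} m (p : Poly k) → coeff (without m p) m ≡ 0ℚ
coeff-without-self m [] = refl
coeff-without-self m ((c , m′) ∷ p) with m′ ≟ₘ m
... | yes _ = coeff-without-self m p
... | no m′≢m with m′ ≟ₘ m
...   | yes m′≡m = ⊥-elim (m′≢m m′≡m)
...   | no _ = coeff-without-self m p

length-without : ∀ {k} m (p : Poly k) → L.length (without m p) ≤ L.length p
length-without m [] = z≤n
length-without m ((c , m′) ∷ p) with m′ ≟ₘ m
... | yes _ = ℕP.m≤n⇒m≤1+n (length-without m p)
... | no _ = s≤s (length-without m p)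

length-without-head : ∀ {k} c m (p : Poly k) → L.length (without m ((c , m) ∷ p)) < suc (L.length p)
length-without-head c m p with m ≟ₘ m
... | yes _ = s≤s (length-without m p)
... | no m≢m = ⊥-elim (m≢m refl)

evalWith : ∀ {k} → Poly k → (Monomial k → ℚ) → ℚ
evalWith [] M = 0ℚ
evalWith ((c , m) ∷ p) M = c * M m + evalWith p M

evalWith-split : ∀ {k} m (p : Poly k) M → evalWith p M ≡ coeff p m * M m + evalWith (without m p) M
evalWith-split m [] M = sym (trans (ℚP.+-identityʳ _) (ℚP.*-zeroˡ (M m)))
evalWith-split m ((c , m′) ∷ p) M with m′ ≟ₘ m
... | yes refl = trans (cong (c * M m +_) (evalWith-split m p M)) (collect c (M m) (coeff p m) _)
  where
  collect : ∀ c x a r → c * x + (a * x + r) ≡ (c + a) * x + r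
  collect = solve 4 (λ c x a r → c :* x :+ (a :* x :+ r) := (c :+ a) :* x :+ r) refl
... | no _ = trans (cong (c * M m′ +_) (evalWith-split m p M))
                   (+-CS.x∙yz≈y∙xz (c * M m′) (coeff p m * M m) (evalWith (without m p) M))

-- By induction on the length: all terms with the head monomial m together contribute coeff p m · M m.
evalWith-vanish : ∀ {k} (p : Poly k) M → (∀ m → coeff p m ≢ 0ℚ → M m ≡ 0ℚ) → evalWith p M ≡ 0ℚ
evalWith-vanish p M = go p (<-wellFounded (L.length p))
  where
  go : ∀ p → Acc _<_ (L.length p) → (∀ m → coeff p m ≢ 0ℚ → M m ≡ 0ℚ) → evalWith p M ≡ 0ℚ
  go [] _ _ = refl
  go p@((c , m) ∷ p′) (acc shorter) M-vanishes = begin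
    evalWith p M                                   ≡⟨ evalWith-split m p M ⟩
    coeff p m * M m + evalWith (without m p) M     ≡⟨ cong₂ _+_ head-term rest ⟩
    0ℚ + 0ℚ                                        ≡⟨ ℚP.+-identityˡ 0ℚ ⟩
    0ℚ                                             ∎
    where
    head-term : coeff p m * M m ≡ 0ℚ
    head-term with coeff p m ℚP.≟ 0ℚ
    ... | yes c≡0 = trans (cong (_* M m) c≡0) (ℚP.*-zeroˡ (M m))
    ... | no c≢0 = trans (cong (coeff p m *_) (M-vanishes m c≢0)) (ℚP.*-zeroʳ (coeff p m))
    rest : evalWith (without m p) M ≡ 0ℚ
    rest = go (without m p) (shorter (length-without-head c m p′)) λ m′ coeff≢0 → M-vanishes m′ λ coeff≡0 →
      coeff≢0 (case m′ ≟ₘ m of λ where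
        (yes refl) → coeff-without-self m p
        (no m′≢m) → trans (coeff-without m m′ p m′≢m) coeff≡0)

-- deg p is degOver p p; generalising the folded list makes it amenable to induction.
degOver : ∀ {k} → Poly k → Poly k → Maybe ℕ
degOver p = L.foldr (λ { (_ , m) D → if ⌊ coeff p m ℚP.≟ 0ℚ ⌋ then D else maxM (just (totalDeg m)) D }) nothing

≤deg-maxMˡ : ∀ {d a} D → d ≤ a → d ≤deg maxM (just a) D
≤deg-maxMˡ nothing d≤a = d≤a
≤deg-maxMˡ {a = a} (just b) d≤a = ℕP.≤-trans d≤a (ℕP.m≤m⊔n a b)

≤deg-maxMʳ : ∀ {d} A D → d ≤deg D → d ≤deg maxM A D
≤deg-maxMʳ nothing D d≤D = d≤D
≤deg-maxMʳ (just a) (just b) d≤b = ℕP.≤-trans d≤b (ℕP.m≤n⊔m a b)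

totalDeg≤deg : ∀ {k} (p : Poly k) m → coeff p m ≢ 0ℚ → totalDeg m ≤deg deg p
totalDeg≤deg p m coeff≢0 = go p coeff≢0
  where
  go : ∀ l → coeff l m ≢ 0ℚ → totalDeg m ≤deg degOver p l
  go [] coeff≢0 = ⊥-elim (coeff≢0 refl)
  go ((c , m′) ∷ l) coeffₗ≢0 with m′ ≟ₘ m | coeff p m′ ℚP.≟ 0ℚ
  ... | yes refl | yes coeff≡0 = ⊥-elim (coeff≢0 coeff≡0)
  ... | yes refl | no _ = ≤deg-maxMˡ (degOver p l) ℕP.≤-refl
  ... | no _ | yes _ = go l coeffₗ≢0
  ... | no _ | no _ = ≤deg-maxMʳ (just (totalDeg m′)) (degOver p l) (go l coeffₗ≢0)

low-degree-support : ∀ {k} d (p : Poly k) → ¬ (d ≤deg deg p) → ∀ m → coeff p m ≢ 0ℚ → totalDeg m < d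
low-degree-support d p d≰deg m coeff≢0 with deg p | totalDeg≤deg p m coeff≢0
... | just e | m≤e = ℕP.≤-<-trans m≤e (ℕP.≰⇒> d≰deg)

maxM-bounded : ∀ {a d} D → a ≤ d → Maybe.All (_≤ d) D → Maybe.All (_≤ d) (maxM (just a) D)
maxM-bounded nothing a≤d _ = Maybe.just a≤d
maxM-bounded (just b) a≤d (Maybe.just b≤d) = Maybe.just (ℕP.⊔-lub a≤d b≤d)

maxM-absorb : ∀ {d} D → Maybe.All (_≤ d) D → maxM (just d) D ≡ just d
maxM-absorb nothing _ = refl
maxM-absorb (just b) (Maybe.just b≤d) = cong just (ℕP.m≥n⇒m⊔n≡m b≤d)

degOver-bounded : ∀ {k d} (p l : Poly k) → All (λ t → totalDeg (proj₂ t) ≤ d) l → Maybe.All (_≤ d) (degOver p l)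
degOver-bounded p [] [] = Maybe.nothing
degOver-bounded p ((c , m) ∷ l) (m≤d ∷ l≤d) with coeff p m ℚP.≟ 0ℚ
... | yes _ = degOver-bounded p l l≤d
... | no _ = maxM-bounded (degOver p l) m≤d (degOver-bounded p l l≤d)

deg-head : ∀ {k} d c (m : Monomial k) rest → coeff ((c , m) ∷ rest) m ≢ 0ℚ → totalDeg m ≡ d →
           All (λ t → totalDeg (proj₂ t) ≤ d) rest → deg ((c , m) ∷ rest) ≡ just d
deg-head d c m rest coeff≢0 refl rest≤d with coeff ((c , m) ∷ rest) m ℚP.≟ 0ℚ
... | yes coeff≡0 = ⊥-elim (coeff≢0 coeff≡0)
... | no _ = maxM-absorb (degOver ((c , m) ∷ rest) rest) (degOver-bounded ((c , m) ∷ rest) rest rest≤d)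

_≤deg?_ : ∀ d D → Dec (d ≤deg D)
d ≤deg? nothing = no λ ()
d ≤deg? just e = d ℕ.≤? e

record IsLinear {k} (Λ : (Vec Bool k → ℚ) → ℚ) : Set where
  field
    extensional : ∀ {F G} → (∀ z → F z ≡ G z) → Λ F ≡ Λ G
    additive    : ∀ F G → Λ (λ z → F z + G z) ≡ Λ F + Λ G
    homogeneous : ∀ c F → Λ (λ z → c * F z) ≡ c * Λ F

  zero-preserving : Λ (λ _ → 0ℚ) ≡ 0ℚ
  zero-preserving = begin
    Λ (λ _ → 0ℚ)        ≡⟨ extensional (λ _ → sym (ℚP.*-zeroˡ 0ℚ)) ⟩
    Λ (λ _ → 0ℚ * 0ℚ)   ≡⟨ homogeneous 0ℚ (λ _ → 0ℚ) ⟩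
    0ℚ * Λ (λ _ → 0ℚ)   ≡⟨ ℚP.*-zeroˡ (Λ (λ _ → 0ℚ)) ⟩
    0ℚ                  ∎

linear-eval : ∀ {k} {Λ : (Vec Bool k → ℚ) → ℚ} → IsLinear Λ →
              ∀ p → Λ (eval p) ≡ evalWith p (λ m → Λ (evalMon m))
linear-eval lin [] = IsLinear.zero-preserving lin
linear-eval {Λ = Λ} lin ((c , m) ∷ p) = begin
  Λ (λ z → c * evalMon m z + eval p z)           ≡⟨ additive _ (eval p) ⟩
  Λ (λ z → c * evalMon m z) + Λ (eval p)         ≡⟨ cong₂ _+_ (homogeneous c (evalMon m)) (linear-eval lin p) ⟩
  c * Λ (evalMon m) + evalWith p (λ m → Λ (evalMon m)) ∎
  where open IsLinear lin

linear-vanishes-on-low-degree :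
  ∀ {k} d {Λ : (Vec Bool k → ℚ) → ℚ} → IsLinear Λ → (∀ m → totalDeg m < d → Λ (evalMon m) ≡ 0ℚ) →
  ∀ p → ¬ (d ≤deg deg p) → Λ (eval p) ≡ 0ℚ
linear-vanishes-on-low-degree d lin Λ-vanishes p d≰deg =
  trans (linear-eval lin p) (evalWith-vanish p _ (λ m coeff≢0 → Λ-vanishes m (low-degree-support d p d≰deg m coeff≢0)))

κ : ℕ → ℕ → ℚ
κ n b = ι (b !) * ι ((n ∸ b) !)

-- profile n G a = Σ_{|y| = a − 1} |y|! (n − |y|)! G y, and profile n G 0 = 0.
profile : ∀ n → (Vec Bool n → ℚ) → ℕ → ℚ
profile n G a = wsum n (λ b → δ a (suc b) * κ n b) G

profile-cong : ∀ n {G H} a → (∀ y → a ≡ suc (weight y) → G y ≡ H y) → profile n G a ≡ profile n H a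
profile-cong n {G} {H} a G≡H = wsum-cong n λ y → begin
  δ a (suc (weight y)) * κ n (weight y) * G y   ≡⟨ ℚP.*-assoc (δ a (suc (weight y))) (κ n (weight y)) (G y) ⟩
  δ a (suc (weight y)) * (κ n (weight y) * G y) ≡⟨ δ-resp a _ (cong (κ n (weight y) *_) ∘ G≡H y) ⟩
  δ a (suc (weight y)) * (κ n (weight y) * H y) ≡⟨ ℚP.*-assoc (δ a (suc (weight y))) (κ n (weight y)) (H y) ⟨
  δ a (suc (weight y)) * κ n (weight y) * H y   ∎

profile-* : ∀ n c G a → profile n (λ y → c * G y) a ≡ c * profile n G a
profile-* n c G a = wsum-* n _ G c

profile-+ : ∀ n G H a → profile n (λ y → G y + H y) a ≡ profile n G a + profile n H a
profile-+ n G H a = wsum-+ n _ G H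

profile-at-0 : ∀ n G → profile n G 0 ≡ 0ℚ
profile-at-0 n G = wsum-zero n (λ y → trans (cong (_* G y) (ℚP.*-zeroˡ (κ n (weight y)))) (ℚP.*-zeroˡ (G y)))

profile-of-0 : ∀ n {G} a → (∀ y → G y ≡ 0ℚ) → profile n G a ≡ 0ℚ
profile-of-0 n {G} a G≡0 = wsum-zero n λ y →
  trans (cong (δ a (suc (weight y)) * κ n (weight y) *_) (G≡0 y)) (ℚP.*-zeroʳ (δ a (suc (weight y)) * κ n (weight y)))

profile-monomial : ∀ n (m : Monomial n) b → b ≤ n →
                   profile n (evalMon m) (suc b) ≡ ι (nonvars m !) * falling (vars m) (ι b)
profile-monomial n m b b≤n = begin
  wsum n (λ w → δ b w * κ n w) (evalMon m)
    ≡⟨ wsum-congʷ n (λ w → trans (δ-resp b w (cong (κ n) ∘ sym)) (ℚP.*-comm (δ b w) (κ n b))) ⟩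
  wsum n (λ w → κ n b * δ b w) (evalMon m)
    ≡⟨ wsum-*ʷ n (δ b) (evalMon m) (κ n b) ⟩
  κ n b * wsum n (δ b) (evalMon m)
    ≡⟨ count-formula m b (n ∸ b) (ℕP.m+[n∸m]≡n b≤n) ⟩
  ι (nonvars m !) * falling (vars m) (ι b) ∎

profile-1ᵐ : ∀ n b → b ≤ n → profile n (evalMon (1ᵐ n)) (suc b) ≡ ι (n !)
profile-1ᵐ n b b≤n = begin
  profile n (evalMon (1ᵐ n)) (suc b)                         ≡⟨ profile-monomial n (1ᵐ n) b b≤n ⟩
  ι (nonvars (1ᵐ n) !) * falling (vars (1ᵐ n)) (ι b)
    ≡⟨ cong₂ (λ z j → ι (z !) * falling j (ι b)) (nonvars-1ᵐ n) (vars-1ᵐ n) ⟩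
  ι (n !) * 1ℚ                                               ≡⟨ ℚP.*-identityʳ (ι (n !)) ⟩
  ι (n !)                                                    ∎

signed-profile-1ᵐ : ∀ n w → w ≤ n → sgn w * profile n (evalMon (1ᵐ n)) w ≡ sgn w * ι (n !) + - ι (n !) * δ 0 w
signed-profile-1ᵐ n zero _ = trans (cong (1ℚ *_) (profile-at-0 n (evalMon (1ᵐ n)))) (cancel (ι (n !)))
  where
  cancel : ∀ c → 1ℚ * 0ℚ ≡ 1ℚ * c + - c * 1ℚ
  cancel = solve 1 (λ c → con 1ℚ :* con 0ℚ := con 1ℚ :* c :+ :- c :* con 1ℚ) refl
signed-profile-1ᵐ n (suc b) 1+b≤n =
  trans (cong (sgn (suc b) *_) (profile-1ᵐ n b (ℕP.<⇒≤ 1+b≤n))) (pad (sgn (suc b)) (ι (n !)))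
  where
  pad : ∀ s c → s * c ≡ s * c + - c * 0ℚ
  pad = solve 2 (λ s c → s :* c := s :* c :+ :- c :* con 0ℚ) refl

jump : ∀ n → (Vec Bool (n ℕ.+ n) → ℚ) → Vec Bool n → Vec Bool n → ℚ
jump n F x y = F (x ++ y) - F (origin n ++ y)

Φ : ∀ n → (Vec Bool (n ℕ.+ n) → ℚ) → ℚ
Φ n F = wsum n sgn (λ x → profile n (jump n F x) (weight x))

Φ-linear : ∀ n → IsLinear (Φ n)
Φ-linear n = record
  { extensional = λ F≡G → wsum-cong n λ x →
      cong (sgn (weight x) *_) (profile-cong n (weight x) (λ y _ → cong₂ _-_ (F≡G _) (F≡G _)))
  ; additive = λ F G → trans
      (wsum-cong n λ x → cong (sgn (weight x) *_) (trans
        (profile-cong n (weight x) (λ y _ → regroup (F (x ++ y)) (G (x ++ y)) (F (o ++ y)) (G (o ++ y))))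
        (profile-+ n (jump n F x) (jump n G x) (weight x))))
      (wsum-+ n sgn _ _)
  ; homogeneous = λ c F → trans
      (wsum-cong n λ x → cong (sgn (weight x) *_) (trans
        (profile-cong n (weight x) (λ y _ → factor c (F (x ++ y)) (F (o ++ y))))
        (profile-* n c (jump n F x) (weight x))))
      (wsum-* n sgn _ c)
  }
  where
  o = origin n
  regroup : ∀ a b a′ b′ → (a + b) - (a′ + b′) ≡ (a - a′) + (b - b′)
  regroup = solve 4 (λ a b a′ b′ → (a :+ b) :- (a′ :+ b′) := (a :- a′) :+ (b :- b′)) refl
  factor : ∀ c a a′ → c * a - c * a′ ≡ c * (a - a′)
  factor = solve 3 (λ c a a′ → c :* a :- c :* a′ := c :* (a :- a′)) refl

jump-monomial : ∀ n (m₁ m₂ : Monomial n) x y →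
                jump n (evalMon (m₁ ++ m₂)) x y ≡ (evalMon m₁ x - evalMon m₁ (origin n)) * evalMon m₂ y
jump-monomial n m₁ m₂ x y = begin
  evalMon (m₁ ++ m₂) (x ++ y) - evalMon (m₁ ++ m₂) (origin n ++ y)
    ≡⟨ cong₂ _-_ (evalMon-++ m₁ m₂ x y) (evalMon-++ m₁ m₂ (origin n) y) ⟩
  evalMon m₁ x * evalMon m₂ y - evalMon m₁ (origin n) * evalMon m₂ y
    ≡⟨ factor (evalMon m₁ x) (evalMon m₁ (origin n)) (evalMon m₂ y) ⟩
  (evalMon m₁ x - evalMon m₁ (origin n)) * evalMon m₂ y ∎
  where
  factor : ∀ a a′ e → a * e - a′ * e ≡ (a - a′) * e
  factor = solve 3 (λ a a′ e → a :* e :- a′ :* e := (a :- a′) :* e) refl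

Φ-vanishes-on-y-monomials : ∀ n (m₁ m₂ : Monomial n) → vars m₁ ≡ 0 → Φ n (evalMon (m₁ ++ m₂)) ≡ 0ℚ
Φ-vanishes-on-y-monomials n m₁ m₂ vars≡0 = wsum-zero n λ x →
  trans (cong (sgn (weight x) *_) (profile-of-0 n (weight x) (jump≡0 x))) (ℚP.*-zeroʳ (sgn (weight x)))
  where
  jump≡0 : ∀ x y → jump n (evalMon (m₁ ++ m₂)) x y ≡ 0ℚ
  jump≡0 x y = begin
    jump n (evalMon (m₁ ++ m₂)) x y                        ≡⟨ jump-monomial n m₁ m₂ x y ⟩
    (evalMon m₁ x - evalMon m₁ (origin n)) * evalMon m₂ y
      ≡⟨ cong₂ (λ u v → (u - v) * evalMon m₂ y) (const x) (const (origin n)) ⟩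
    (1ℚ - 1ℚ) * evalMon m₂ y                               ≡⟨ ℚP.*-zeroˡ (evalMon m₂ y) ⟩
    0ℚ                                                     ∎
    where
    const = evalMon-const m₁ vars≡0

Φ-vanishes-on-mixed-monomials :
  ∀ n (m₁ m₂ : Monomial n) → 1 ≤ vars m₁ → vars m₁ ℕ.+ vars m₂ < n → Φ n (evalMon (m₁ ++ m₂)) ≡ 0ℚ
Φ-vanishes-on-mixed-monomials n m₁ m₂ 1≤vars small = begin
  Φ n (evalMon (m₁ ++ m₂))                  ≡⟨ wsum-cong n summand ⟩
  wsum n (λ a → sgn a * K a) (evalMon m₁)   ≡⟨ alternating-wsum-vanishes m₁ K K-degree ⟩
  0ℚ                                        ∎
  where
  j = vars m₂
  K : ℕ → ℚ
  K a = ι (nonvars m₂ !) * falling j (ι a - 1ℚ)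

  K-degree : Deg< (nonvars m₁) K
  K-degree = Deg<-≤ K 1+j≤nonvars (Deg<-* (suc j) (ι (nonvars m₂ !)) _ (Deg<-falling j (- 1ℚ)))
    where
    1+j≤nonvars : suc j ≤ nonvars m₁
    1+j≤nonvars = ℕP.+-cancelˡ-≤ (vars m₁) (suc j) (nonvars m₁)
      (subst₂ _≤_ (sym (ℕP.+-suc (vars m₁) j)) (sym (vars+nonvars m₁)) small)

  jump≡ : ∀ x y → jump n (evalMon (m₁ ++ m₂)) x y ≡ evalMon m₁ x * evalMon m₂ y
  jump≡ x y = begin
    jump n (evalMon (m₁ ++ m₂)) x y                        ≡⟨ jump-monomial n m₁ m₂ x y ⟩
    (evalMon m₁ x - evalMon m₁ (origin n)) * evalMon m₂ y
      ≡⟨ cong (λ t → (evalMon m₁ x - t) * evalMon m₂ y) (evalMon-origin m₁ 1≤vars) ⟩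
    (evalMon m₁ x - 0ℚ) * evalMon m₂ y                     ≡⟨ cong (_* evalMon m₂ y) (ℚP.+-identityʳ (evalMon m₁ x)) ⟩
    evalMon m₁ x * evalMon m₂ y                            ∎

  -- At level 0 the profile and K differ, but there m₁ vanishes.
  profile≡K : ∀ x w → weight x ≡ w → evalMon m₁ x * profile n (evalMon m₂) w ≡ evalMon m₁ x * K w
  profile≡K x zero w≡0 = begin
    evalMon m₁ x * profile n (evalMon m₂) 0   ≡⟨ cong (_* profile n (evalMon m₂) 0) x-vanishes ⟩
    0ℚ * profile n (evalMon m₂) 0             ≡⟨ ℚP.*-zeroˡ (profile n (evalMon m₂) 0) ⟩
    0ℚ                                        ≡⟨ ℚP.*-zeroˡ (K 0) ⟨
    0ℚ * K 0                                  ≡⟨ cong (_* K 0) x-vanishes ⟨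
    evalMon m₁ x * K 0                        ∎
    where
    x-vanishes : evalMon m₁ x ≡ 0ℚ
    x-vanishes = trans (cong (evalMon m₁) (weight≡0 x w≡0)) (evalMon-origin m₁ 1≤vars)
  profile≡K x (suc b) w≡1+b = cong (evalMon m₁ x *_) (trans
    (profile-monomial n m₂ b (ℕP.<⇒≤ (subst (_≤ n) w≡1+b (weight≤ x))))
    (cong (λ r → ι (nonvars m₂ !) * falling j r) (ι-pred b)))

  summand : ∀ x → sgn (weight x) * profile n (jump n (evalMon (m₁ ++ m₂)) x) (weight x)
                 ≡ sgn (weight x) * K (weight x) * evalMon m₁ x
  summand x = begin
    sgn w * profile n (jump n (evalMon (m₁ ++ m₂)) x) w  ≡⟨ cong (sgn w *_) (profile-cong n w (λ y _ → jump≡ x y)) ⟩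
    sgn w * profile n (λ y → evalMon m₁ x * evalMon m₂ y) w
                                                        ≡⟨ cong (sgn w *_) (profile-* n (evalMon m₁ x) (evalMon m₂) w) ⟩
    sgn w * (evalMon m₁ x * profile n (evalMon m₂) w)   ≡⟨ cong (sgn w *_) (profile≡K x w refl) ⟩
    sgn w * (evalMon m₁ x * K w)                         ≡⟨ *-CS.x∙yz≈xz∙y (sgn w) (evalMon m₁ x) (K w) ⟩
    sgn w * K w * evalMon m₁ x                           ∎
    where
    w = weight x

Φ-vanishes-on-low-degree : ∀ n (m : Monomial (n ℕ.+ n)) → totalDeg m < n → Φ n (evalMon m) ≡ 0ℚ
Φ-vanishes-on-low-degree n m deg<n with Vec.splitAt n m
... | m₁ , m₂ , refl with vars m₁ in vars≡
...   | zero = Φ-vanishes-on-y-monomials n m₁ m₂ vars≡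
...   | suc _ = Φ-vanishes-on-mixed-monomials n m₁ m₂ (subst (1 ≤_) (sym vars≡) (s≤s z≤n))
    (ℕP.≤-<-trans (ℕP.+-mono-≤ (vars≤totalDeg m₁) (vars≤totalDeg m₂)) (subst (_< n) (totalDeg-++ m₁ m₂) deg<n))

Φ-forced-value : ∀ n (F : Vec Bool (suc n ℕ.+ suc n) → ℚ) →
                 (∀ y → F (origin (suc n) ++ y) ≡ 0ℚ) →
                 (∀ x y → weight x ≡ suc (weight y) → F (x ++ y) ≡ 1ℚ) →
                 Φ (suc n) F ≡ - ι (suc n !)
Φ-forced-value n F F₀≡0 F₁≡1 = begin
  Φ N F
    ≡⟨ wsum-cong N summand ⟩
  wsum N ω E
    ≡⟨ wsum-+ʷ N _ _ E ⟩
  wsum N (λ a → sgn a * c) E + wsum N (λ a → - c * δ 0 a) E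
    ≡⟨ cong₂ _+_ (alternating-wsum-vanishes (1ᵐ N) (λ _ → c) constant-degree) (wsum-*ʷ N (δ 0) E (- c)) ⟩
  0ℚ + - c * wsum N (δ 0) E
    ≡⟨ cong (λ t → 0ℚ + - c * t) (trans (wsum-δ₀ N E) (E≡1 (origin N))) ⟩
  0ℚ + - c * 1ℚ
    ≡⟨ simplify c ⟩
  - c ∎
  where
  N = suc n
  c = ι (N !)
  E = evalMon (1ᵐ N)

  ω : ℕ → ℚ
  ω a = sgn a * c + - c * δ 0 a

  E≡1 : ∀ x → E x ≡ 1ℚ
  E≡1 = evalMon-const (1ᵐ N) (vars-1ᵐ N)

  constant-degree : Deg< (nonvars (1ᵐ N)) (λ _ → c)
  constant-degree = Deg<-≤ {d′ = nonvars (1ᵐ n)} (Δ (λ _ → c)) z≤n (λ _ → ℚP.+-inverseʳ c)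

  simplify : ∀ c → 0ℚ + - c * 1ℚ ≡ - c
  simplify = solve 1 (λ c → con 0ℚ :+ :- c :* con 1ℚ := :- c) refl

  jump≡E : ∀ x y → weight x ≡ suc (weight y) → jump N F x y ≡ E y
  jump≡E x y w≡1+w′ = begin
    F (x ++ y) - F (origin N ++ y) ≡⟨ cong₂ _-_ (F₁≡1 x y w≡1+w′) (F₀≡0 y) ⟩
    1ℚ - 0ℚ                        ≡⟨ E≡1 y ⟨
    E y                            ∎

  summand : ∀ x → sgn (weight x) * profile N (jump N F x) (weight x) ≡ ω (weight x) * E x
  summand x = begin
    sgn w * profile N (jump N F x) w   ≡⟨ cong (sgn w *_) (profile-cong N w (jump≡E x)) ⟩
    sgn w * profile N E w              ≡⟨ signed-profile-1ᵐ N w (weight≤ x) ⟩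
    ω w                                ≡⟨ ℚP.*-identityʳ (ω w) ⟨
    ω w * 1ℚ                           ≡⟨ cong (ω w *_) (E≡1 x) ⟨
    ω w * E x                          ∎
    where
    w = weight x

degree-lower-bound : ∀ n (p : Poly (suc n ℕ.+ suc n)) →
                     (∀ y → eval p (origin (suc n) ++ y) ≡ 0ℚ) →
                     (∀ x y → weight x ≡ suc (weight y) → eval p (x ++ y) ≡ 1ℚ) →
                     suc n ≤deg deg p
degree-lower-bound n p p₀≡0 p₁≡1 = decidable-stable (suc n ≤deg? deg p) λ low-degree →
  ι-≢0 (ℕP.1≤n! (suc n)) (ℚP.neg-injective (begin
    - ι (suc n !)        ≡⟨ Φ-forced-value n (eval p) p₀≡0 p₁≡1 ⟨
    Φ (suc n) (eval p)   ≡⟨ linear-vanishes-on-low-degree (suc n) (Φ-linear (suc n))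
                                                           (Φ-vanishes-on-low-degree (suc n)) p low-degree ⟩
    - 0ℚ                 ∎))

varSum : ∀ {k} n → ℚ → (Monomial n → Monomial k) → Poly k
varSum zero c f = []
varSum (suc n) c f = (c , f (1 ∷ 1ᵐ n)) ∷ varSum n c (f ∘ (0 ∷_))

eval-varSum : ∀ {k} n c (f : Monomial n → Monomial k) z x →
              (∀ e → evalMon (f e) z ≡ evalMon e x) → eval (varSum n c f) z ≡ c * ι (weight x)
eval-varSum zero c f z [] _ = sym (ℚP.*-zeroʳ c)
eval-varSum (suc n) c f z (b ∷ x) f-eval = begin
  c * evalMon (f (1 ∷ 1ᵐ n)) z + eval (varSum n c (f ∘ (0 ∷_))) z
    ≡⟨ cong₂ (λ u v → c * u + v) (f-eval (1 ∷ 1ᵐ n))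
             (eval-varSum n c (f ∘ (0 ∷_)) z x (λ e → trans (f-eval (0 ∷ e)) (ℚP.*-identityˡ (evalMon e x)))) ⟩
  c * (powQ (bit b) 1 * evalMon (1ᵐ n) x) + c * ι (weight x)
    ≡⟨ cong (λ t → c * (powQ (bit b) 1 * t) + c * ι (weight x)) (evalMon-const (1ᵐ n) (vars-1ᵐ n) x) ⟩
  c * (powQ (bit b) 1 * 1ℚ) + c * ι (weight x)
    ≡⟨ ℚP.*-distribˡ-+ c _ _ ⟨
  c * (powQ (bit b) 1 * 1ℚ + ι (weight x))
    ≡⟨ cong (c *_) (bit-weight b) ⟩
  c * ι (weight (b ∷ x)) ∎
  where
  bit-weight : ∀ b → powQ (bit b) 1 * 1ℚ + ι (weight x) ≡ ι (weight (b ∷ x))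
  bit-weight true = refl
  bit-weight false = ℚP.+-identityˡ (ι (weight x))

varSum-All : ∀ {k} {P : Monomial k → Set} n c f →
             (∀ e → totalDeg e ≡ 1 → P (f e)) → All (P ∘ proj₂) (varSum n c f)
varSum-All zero c f _ = []
varSum-All (suc n) c f P-f = P-f (1 ∷ 1ᵐ n) (cong suc (totalDeg-1ᵐ n)) ∷ varSum-All n c (f ∘ (0 ∷_)) (P-f ∘ (0 ∷_))

-- g₁ = X₁ + ⋯ + Xₙ and g₂ = X₁ + ⋯ + Xₙ − Y₁ − ⋯ − Yₙ − 1.
g₁ g₂ : ∀ n → Poly (n ℕ.+ n)
g₁ n = varSum n 1ℚ (_++ 1ᵐ n)
g₂ n = g₁ n L.++ varSum n (- 1ℚ) (1ᵐ n ++_) L.++ L.[ (- 1ℚ , 1ᵐ (n ℕ.+ n)) ]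

eval-g₁ : ∀ n (x y : Vec Bool n) → eval (g₁ n) (x ++ y) ≡ ι (weight x)
eval-g₁ n x y = trans (eval-varSum n 1ℚ (_++ 1ᵐ n) (x ++ y) x X-only) (ℚP.*-identityˡ _)
  where
  X-only : ∀ e → evalMon (e ++ 1ᵐ n) (x ++ y) ≡ evalMon e x
  X-only e = trans (evalMon-++ e (1ᵐ n) x y)
                   (trans (cong (evalMon e x *_) (evalMon-const (1ᵐ n) (vars-1ᵐ n) y)) (ℚP.*-identityʳ _))

eval-g₂ : ∀ n (x y : Vec Bool n) → eval (g₂ n) (x ++ y) ≡ ι (weight x) - ι (suc (weight y))
eval-g₂ n x y = begin
  eval (g₁ n L.++ Ys L.++ L.[ (- 1ℚ , 1ᵐ (n ℕ.+ n)) ]) (x ++ y)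
    ≡⟨ eval-++ (g₁ n) _ (x ++ y) ⟩
  eval (g₁ n) (x ++ y) + eval (Ys L.++ L.[ (- 1ℚ , 1ᵐ (n ℕ.+ n)) ]) (x ++ y)
    ≡⟨ cong (eval (g₁ n) (x ++ y) +_) (eval-++ Ys _ (x ++ y)) ⟩
  eval (g₁ n) (x ++ y) + (eval Ys (x ++ y) + (- 1ℚ * evalMon (1ᵐ (n ℕ.+ n)) (x ++ y) + 0ℚ))
    ≡⟨ cong₂ (λ u v → u + (v + (- 1ℚ * evalMon (1ᵐ (n ℕ.+ n)) (x ++ y) + 0ℚ))) (eval-g₁ n x y) eval-Ys ⟩
  ι (weight x) + (- 1ℚ * ι (weight y) + (- 1ℚ * evalMon (1ᵐ (n ℕ.+ n)) (x ++ y) + 0ℚ))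
    ≡⟨ cong (λ t → ι (weight x) + (- 1ℚ * ι (weight y) + (- 1ℚ * t + 0ℚ)))
            (evalMon-const (1ᵐ (n ℕ.+ n)) (vars-1ᵐ (n ℕ.+ n)) (x ++ y)) ⟩
  ι (weight x) + (- 1ℚ * ι (weight y) + (- 1ℚ * 1ℚ + 0ℚ))
    ≡⟨ collect (ι (weight x)) (ι (weight y)) ⟩
  ι (weight x) - (1ℚ + ι (weight y)) ∎
  where
  Ys = varSum n (- 1ℚ) (1ᵐ n ++_)
  eval-Ys : eval Ys (x ++ y) ≡ - 1ℚ * ι (weight y)
  eval-Ys = eval-varSum n (- 1ℚ) (1ᵐ n ++_) (x ++ y) y λ e →
    trans (evalMon-++ (1ᵐ n) e x y) (trans (cong (_* evalMon e y) (evalMon-const (1ᵐ n) (vars-1ᵐ n) x)) (ℚP.*-identityˡ _))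
  collect : ∀ a b → a + (- 1ℚ * b + (- 1ℚ * 1ℚ + 0ℚ)) ≡ a - (1ℚ + b)
  collect = solve 2 (λ a b → a :+ (:- con 1ℚ :* b :+ (:- con 1ℚ :* con 1ℚ :+ con 0ℚ)) := a :- (con 1ℚ :+ b)) refl

no-common-zero : ∀ n (z : Vec Bool (n ℕ.+ n)) → ¬ (eval (g₁ n) z ≡ 0ℚ × eval (g₂ n) z ≡ 0ℚ)
no-common-zero n z with Vec.splitAt n z
... | x , y , refl = λ (g₁≡0 , g₂≡0) → ι-≢0 {suc (weight y)} (s≤s z≤n) (begin
  ι (suc (weight y))                                    ≡⟨ recover (ι (weight x)) _ ⟩
  ι (weight x) - (ι (weight x) - ι (suc (weight y)))
    ≡⟨ cong₂ _-_ (trans (sym (eval-g₁ n x y)) g₁≡0) (trans (sym (eval-g₂ n x y)) g₂≡0) ⟩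
  0ℚ - 0ℚ                                               ≡⟨ ℚP.+-inverseʳ 0ℚ ⟩
  0ℚ                                                    ∎)
  where
  recover : ∀ a b → b ≡ a - (a - b)
  recover = solve 2 (λ a b → b := a :- (a :- b)) refl

LinearWithoutX₁ : ∀ n → ℚ × Monomial (suc n ℕ.+ suc n) → Set
LinearWithoutX₁ n (_ , m) = totalDeg m ≤ 1 × Vec.head m ≡ 0

X₁ : ∀ n → Monomial (suc n ℕ.+ suc n)
X₁ n = (1 ∷ 1ᵐ n) ++ 1ᵐ (suc n)

deg-X₁-head : ∀ n rest → All (LinearWithoutX₁ n) rest →
              deg ((1ℚ , X₁ n) ∷ rest) ≡ just 1
deg-X₁-head n rest lower = deg-head 1 1ℚ (X₁ n) rest coeff≢0 totalDeg-X₁ (All.map proj₁ lower)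
  where
  coeff≢0 : coeff ((1ℚ , X₁ n) ∷ rest) (X₁ n) ≢ 0ℚ
  coeff≢0 coeff≡0 = ι-≢0 {1} (s≤s z≤n) (begin
    1ℚ + 0ℚ                             ≡⟨ cong (1ℚ +_) (coeff-absent (X₁ n) rest (All.map (λ {t} → ≢X₁ {t}) lower)) ⟨
    1ℚ + coeff rest (X₁ n)              ≡⟨ coeff-head 1ℚ (X₁ n) rest ⟨
    coeff ((1ℚ , X₁ n) ∷ rest) (X₁ n)   ≡⟨ coeff≡0 ⟩
    0ℚ                                  ∎)
    where
    ≢X₁ : ∀ {t} → LinearWithoutX₁ n t → proj₂ t ≢ X₁ n
    ≢X₁ (_ , head≡0) t≡X₁ = 0≢1 (trans (sym head≡0) (cong Vec.head t≡X₁))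
      where
      0≢1 : 0 ≢ 1
      0≢1 ()
  totalDeg-X₁ : totalDeg (X₁ n) ≡ 1
  totalDeg-X₁ = trans (totalDeg-padʳ (suc n) (1 ∷ 1ᵐ n)) (cong suc (totalDeg-1ᵐ n))

g₁-tail-linear : ∀ n → All (LinearWithoutX₁ n) (varSum n 1ℚ (λ e → (0 ∷ e) ++ 1ᵐ (suc n)))
g₁-tail-linear n = varSum-All n 1ℚ _ λ e deg≡1 → ℕP.≤-reflexive (trans (totalDeg-padʳ (suc n) e) deg≡1) , refl

deg-g₁ : ∀ n → deg (g₁ (suc n)) ≡ just 1
deg-g₁ n = deg-X₁-head n _ (g₁-tail-linear n)

deg-g₂ : ∀ n → deg (g₂ (suc n)) ≡ just 1
deg-g₂ n = deg-X₁-head n _ (AllP.++⁺ (g₁-tail-linear n) (AllP.++⁺ y-terms (constant-term ∷ [])))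
  where
  y-terms : All (LinearWithoutX₁ n) (varSum (suc n) (- 1ℚ) (1ᵐ (suc n) ++_))
  y-terms = varSum-All (suc n) (- 1ℚ) (1ᵐ (suc n) ++_) λ e deg≡1 →
    ℕP.≤-reflexive (trans (totalDeg-padˡ (suc n) e) deg≡1) , refl
  constant-term : LinearWithoutX₁ n (- 1ℚ , 1ᵐ (suc n ℕ.+ suc n))
  constant-term = ℕP.≤-trans (ℕP.≤-reflexive (totalDeg-1ᵐ (suc n ℕ.+ suc n))) z≤n , refl

h₁g₁-on-origin : ∀ n h y → eval (multilin (h *P g₁ n)) (origin n ++ y) ≡ 0ℚ
h₁g₁-on-origin n h y = begin
  eval (multilin (h *P g₁ n)) (origin n ++ y)          ≡⟨ eval-multilin-*P h (g₁ n) (origin n ++ y) ⟩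
  eval h (origin n ++ y) * eval (g₁ n) (origin n ++ y) ≡⟨ cong (eval h (origin n ++ y) *_) g₁-origin ⟩
  eval h (origin n ++ y) * 0ℚ                          ≡⟨ ℚP.*-zeroʳ (eval h (origin n ++ y)) ⟩
  0ℚ                                                   ∎
  where
  g₁-origin : eval (g₁ n) (origin n ++ y) ≡ 0ℚ
  g₁-origin = trans (eval-g₁ n (origin n) y) (cong ι (weight-origin n))

h₁g₁-on-diagonal : ∀ n h₁ h₂ → (∀ z → eval h₁ z * eval (g₁ n) z + eval h₂ z * eval (g₂ n) z ≡ 1ℚ) →
                   ∀ x y → weight x ≡ suc (weight y) → eval (multilin (h₁ *P g₁ n)) (x ++ y) ≡ 1ℚ
h₁g₁-on-diagonal n h₁ h₂ bezout x y x-heavier = begin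
  eval (multilin (h₁ *P g₁ n)) z         ≡⟨ eval-multilin-*P h₁ (g₁ n) z ⟩
  H₁G₁                                   ≡⟨ ℚP.+-identityʳ H₁G₁ ⟨
  H₁G₁ + 0ℚ                              ≡⟨ cong (H₁G₁ +_) (ℚP.*-zeroʳ (eval h₂ z)) ⟨
  H₁G₁ + eval h₂ z * 0ℚ                  ≡⟨ cong (λ t → H₁G₁ + eval h₂ z * t) g₂-diagonal ⟨
  H₁G₁ + eval h₂ z * eval (g₂ n) z       ≡⟨ bezout z ⟩
  1ℚ                                     ∎
  where
  z = x ++ y
  H₁G₁ = eval h₁ z * eval (g₁ n) z
  g₂-diagonal : eval (g₂ n) z ≡ 0ℚ
  g₂-diagonal = begin
    eval (g₂ n) z                             ≡⟨ eval-g₂ n x y ⟩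
    ι (weight x) - ι (suc (weight y))         ≡⟨ cong (λ w → ι w - ι (suc (weight y))) x-heavier ⟩
    ι (suc (weight y)) - ι (suc (weight y))   ≡⟨ ℚP.+-inverseʳ (ι (suc (weight y))) ⟩
    0ℚ                                        ∎

fact4p3 : (n : ℕ) → 1 ≤ n →
    Σ (Poly (n ℕ.+ n)) λ g₁ → Σ (Poly (n ℕ.+ n)) λ g₂ →
      deg g₁ ≡ just 1 × deg g₂ ≡ just 1 ×
      (∀ (z : Vec Bool (n ℕ.+ n)) → ¬ (eval g₁ z ≡ 0ℚ × eval g₂ z ≡ 0ℚ)) ×
      (∀ (h₁ h₂ : Poly (n ℕ.+ n)) →
        (∀ (z : Vec Bool (n ℕ.+ n)) → eval h₁ z * eval g₁ z + eval h₂ z * eval g₂ z ≡ 1ℚ) →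
        (n ≤deg deg (multilin (h₁ *P g₁))) ⊎ (n ≤deg deg (multilin (h₂ *P g₂))))
fact4p3 (suc n) (s≤s z≤n) =
  g₁ (suc n) , g₂ (suc n) , deg-g₁ n , deg-g₂ n , no-common-zero (suc n) , λ h₁ h₂ bezout →
    inj₁ (degree-lower-bound n (multilin (h₁ *P g₁ (suc n)))
                             (h₁g₁-on-origin (suc n) h₁) (h₁g₁-on-diagonal (suc n) h₁ h₂ bezout))
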